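{- For all integers $2 \leq k < r$, $e \geq 3$, $d \geq 1$ and $n\ge 1$, $$ f_r(n,(r-k)e + k + d,e) \leq \binom{r}{3}e\, n^{k-2} \cdot f_3(n,e + 2 + d,e). $$
   Context: An $r$-uniform hypergraph ($r$-graph) has a vertex set of size $n$ and an edge set consisting of $r$-element subsets of the vertex set. A $(v,e)$-configuration is a hypergraph with exactly $e$ edges and at most $v$ vertices; an $r$-graph contains a $(v,e)$-configuration if it has $e$ edges whose union has at most $v$ vertices. $f_r(n,v,e)$ denotes the largest number of edges in an $n$-vertex $r$-graph containing no $(v,e)$-configuration. -}

module Defs where

open import Data.Nat using (ℕ; _≤_)
open import Data.Fin.Subset using (Subset; ∣_∣; ⋃)
open import Data.List using (List; length)
open import Data.List.Relation.Unary.All using (All)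
open import Data.List.Relation.Unary.Unique.Propositional using (Unique)
open import Data.List.Membership.Propositional using (_∈_)
open import Data.Product using (_×_; Σ; ∃)
open import Relation.Binary.PropositionalEquality using (_≡_)
open import Relation.Nullary using (¬_)

record Hypergraph (r n : ℕ) : Set where
  field
    edges   : List (Subset n)
    uniform : All (λ E → ∣ E ∣ ≡ r) edges
    simple  : Unique edges

open Hypergraph public

numEdges : ∀ {r n} → Hypergraph r n → ℕ
numEdges H = length (edges H)

ContainsConfig : ∀ {r n} → ℕ → ℕ → Hypergraph r n → Set
ContainsConfig v e H =
  Σ (List (Subset _)) λ L →
    Unique L × All (λ E → E ∈ edges H) L × length L ≡ e × ∣ ⋃ L ∣ ≤ v

-- IsF r n v e m : m = f_r(n,v,e), i.e. m is the largest number of edges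
-- of an n-vertex r-graph containing no (v,e)-configuration.
IsF : ℕ → ℕ → ℕ → ℕ → ℕ → Set
IsF r n v e m =
  (Σ (Hypergraph r n) λ H → ¬ ContainsConfig v e H × numEdges H ≡ m)
  × (∀ (H : Hypergraph r n) → ¬ ContainsConfig v e H → numEdges H ≤ m)

module Submission where

-- Write k = 2 + j and r = j + (3 + s); then the configuration order is
-- (r - k) e + k + d = j + ((e + 2 + d) + e s).
--
-- Links: the link of a vertex x in an (r+1)-graph H (edges through x, with x
-- removed) is an r-graph, and a (v,e)-configuration in it gives a
-- (v+1,e)-configuration in H.  Double counting edges over their vertices gives
-- |H| ≤ n · max |link|; iterating j times passes to (3+s)-graphs at cost n^j.
--
-- Traces: send each edge of a (3+s)-graph to its 3 smallest vertices.  With no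
-- ((e+2+d) + e s, e)-configuration, every fibre has at most e edges and the
-- image 3-graph has no (e+2+d, e)-configuration, so |H| ≤ e · f_3(n,e+2+d,e).

open import Defs
open import Data.Nat using (ℕ; zero; suc; _+_; _*_; _∸_; _^_; _≤_; _<_; z≤n; s≤s; _≤?_)
open import Data.Nat.Properties
open import Data.Nat.ListAction using (sum)
open import Data.Nat.Combinatorics using (_C_; nCk+nC[k+1]≡[n+1]C[k+1])
open import Data.Nat.Tactic.RingSolver using (solve-∀)
open import Data.Bool using (true; false; not)
import Data.Bool.Properties as Bool
open import Data.Fin using (Fin; zero; suc) renaming (_≟_ to _≟ᶠ_)
open import Data.Vec using ([]; _∷_; here; there; updateAt)
open import Data.Vec.Properties using (≡-dec; updateAt-updateAt; updateAt-cong; updateAt-id; updateAt-minimal)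
open import Data.Fin.Subset using (Subset; ⋃; ∣_∣; _∪_; ⊥; ⁅_⁆; _⊆_; Nonempty) renaming (_∈_ to _∈ₛ_)
open import Data.Fin.Subset.Properties
  using (_∈?_; nonempty?; Empty-unique; ∣⊥∣≡0; ∣⁅x⁆∣≡1; x∈⁅x⁆; p⊆q⇒∣p∣≤∣q∣; p⊆p∪q; q⊆p∪q;
         x∈p∪q⁻; x∈p∪q⁺; ∉⊥; ⊆-trans; ⊆-refl; ⊆-reflexive; ∪-identityˡ)
open import Data.List using (List; []; _∷_; map; length; filter; take; deduplicate; allFin)
open import Data.List.Properties using (length-map; length-take; length-tabulate)
open import Data.List.Relation.Unary.All as All using (All; []; _∷_)
open import Data.List.Relation.Unary.Any using (Any; here; there)
import Data.List.Membership.Propositional as List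
import Data.List.Membership.Propositional.Properties as List
import Data.List.Relation.Unary.All.Properties as All
import Data.List.Relation.Unary.Unique.Propositional.Properties as Unique
import Data.List.Relation.Unary.Unique.DecPropositional.Properties as Unique
open import Data.Product using (Σ; ∃; _,_; _×_; proj₁)
open import Data.Sum using (inj₁; inj₂)
open import Relation.Nullary using (¬_; Dec; yes; no; contradiction)
open import Relation.Unary using (Decidable)
open import Relation.Binary.PropositionalEquality
open import Function using (id)

private variable n : ℕ

_≟ₛ_ : (p q : Subset n) → Dec (p ≡ q)
_≟ₛ_ = ≡-dec Bool._≟_

∣p∪q∣≤∣p∣+∣q∣ : (p q : Subset n) → ∣ p ∪ q ∣ ≤ ∣ p ∣ + ∣ q ∣
∣p∪q∣≤∣p∣+∣q∣ []          []          = z≤n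
∣p∪q∣≤∣p∣+∣q∣ (true ∷ p)  (true ∷ q)  = s≤s (≤-trans (∣p∪q∣≤∣p∣+∣q∣ p q) (+-monoʳ-≤ ∣ p ∣ (n≤1+n ∣ q ∣)))
∣p∪q∣≤∣p∣+∣q∣ (true ∷ p)  (false ∷ q) = s≤s (∣p∪q∣≤∣p∣+∣q∣ p q)
∣p∪q∣≤∣p∣+∣q∣ (false ∷ p) (true ∷ q)  = ≤-trans (s≤s (∣p∪q∣≤∣p∣+∣q∣ p q)) (≤-reflexive (sym (+-suc ∣ p ∣ ∣ q ∣)))
∣p∪q∣≤∣p∣+∣q∣ (false ∷ p) (false ∷ q) = ∣p∪q∣≤∣p∣+∣q∣ p q

∣⋃∣≤length*size : ∀ {t} (M : List (Subset n)) → All (λ E → ∣ E ∣ ≤ t) M → ∣ ⋃ M ∣ ≤ length M * t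
∣⋃∣≤length*size {n} [] [] = ≤-reflexive (∣⊥∣≡0 n)
∣⋃∣≤length*size (E ∷ M) (bE ∷ bM) = ≤-trans (∣p∪q∣≤∣p∣+∣q∣ E (⋃ M)) (+-mono-≤ bE (∣⋃∣≤length*size M bM))

⋃-upper : ∀ {E} (M : List (Subset n)) → E List.∈ M → E ⊆ ⋃ M
⋃-upper (E ∷ M) (here refl) = p⊆p∪q (⋃ M)
⋃-upper (F ∷ M) (there E∈M) = ⊆-trans (⋃-upper M E∈M) (q⊆p∪q F (⋃ M))

⋃-least : ∀ {A} (M : List (Subset n)) → All (_⊆ A) M → ⋃ M ⊆ A
⋃-least []      []                x∈⋃ = contradiction x∈⋃ ∉⊥
⋃-least (E ∷ M) (E⊆A ∷ M⊆A) x∈⋃ with x∈p∪q⁻ E (⋃ M) x∈⋃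
... | inj₁ x∈E  = E⊆A x∈E
... | inj₂ x∈⋃M = ⋃-least M M⊆A x∈⋃M

∪-mono : ∀ {p p′ q q′ : Subset n} → p ⊆ p′ → q ⊆ q′ → p ∪ q ⊆ p′ ∪ q′
∪-mono {p = p} {q = q} p⊆p′ q⊆q′ x∈ with x∈p∪q⁻ p q x∈
... | inj₁ x∈p = x∈p∪q⁺ (inj₁ (p⊆p′ x∈p))
... | inj₂ x∈q = x∈p∪q⁺ (inj₂ (q⊆q′ x∈q))

sum-map-mono : ∀ {I : Set} (is : List I) {f g : I → ℕ} → (∀ i → f i ≤ g i) → sum (map f is) ≤ sum (map g is)
sum-map-mono []       f≤g = z≤n
sum-map-mono (i ∷ is) f≤g = +-mono-≤ (f≤g i) (sum-map-mono is f≤g)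

sum-map-bound : ∀ {I : Set} (is : List I) {f : I → ℕ} {c} → (∀ i → f i ≤ c) → sum (map f is) ≤ length is * c
sum-map-bound []       f≤c = z≤n
sum-map-bound (i ∷ is) f≤c = +-mono-≤ (f≤c i) (sum-map-bound is f≤c)

module DoubleCounting {I A : Set} (P : I → A → Set) (P? : ∀ i → Decidable (P i)) where

  degree : I → List A → ℕ
  degree i L = length (filter (P? i) L)

  degree-cons : ∀ i a L → degree i L ≤ degree i (a ∷ L)
  degree-cons i a L with P? i a
  ... | yes _ = n≤1+n _
  ... | no  _ = ≤-refl

  degree-cons-∈ : ∀ {i a} L → P i a → suc (degree i L) ≤ degree i (a ∷ L)
  degree-cons-∈ {i} {a} L Pia with P? i a
  ... | yes _   = ≤-refl
  ... | no ¬Pia = contradiction Pia ¬Pia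

  total-degree-cons : ∀ {a} L (is : List I) → Any (λ i → P i a) is →
    suc (sum (map (λ i → degree i L) is)) ≤ sum (map (λ i → degree i (a ∷ L)) is)
  total-degree-cons {a} L (i ∷ is) (here Pia) =
    +-mono-≤ (degree-cons-∈ L Pia) (sum-map-mono is (λ i′ → degree-cons i′ a L))
  total-degree-cons {a} L (i ∷ is) (there cov) =
    ≤-trans (≤-reflexive (sym (+-suc (degree i L) _))) (+-mono-≤ (degree-cons i a L) (total-degree-cons L is cov))

  double-count : ∀ (is : List I) L → All (λ a → Any (λ i → P i a) is) L →
    length L ≤ sum (map (λ i → degree i L) is)
  double-count is []      []           = z≤n
  double-count is (a ∷ L) (cov ∷ covs) = ≤-trans (s≤s (double-count is L covs)) (total-degree-cons L is cov)

toggle : Fin n → Subset n → Subset n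
toggle x p = updateAt p x not

toggle-involutive : ∀ (x : Fin n) p → toggle x (toggle x p) ≡ p
toggle-involutive x p = begin
  updateAt (updateAt p x not) x not ≡⟨ updateAt-updateAt x p ⟩
  updateAt p x (λ b → not (not b))  ≡⟨ updateAt-cong x Bool.not-involutive p ⟩
  updateAt p x id                   ≡⟨ updateAt-id x p ⟩
  p                                 ∎
  where open ≡-Reasoning

toggle-injective : ∀ (x : Fin n) {p q} → toggle x p ≡ toggle x q → p ≡ q
toggle-injective x {p} {q} eq = begin
  p                       ≡⟨ toggle-involutive x p ⟨
  toggle x (toggle x p)   ≡⟨ cong (toggle x) eq ⟩
  toggle x (toggle x q)   ≡⟨ toggle-involutive x q ⟩
  q                       ∎
  where open ≡-Reasoning

toggle-size : ∀ (x : Fin n) p → x ∈ₛ p → suc ∣ toggle x p ∣ ≡ ∣ p ∣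
toggle-size zero    (true ∷ p)  here       = refl
toggle-size (suc x) (true ∷ p)  (there x∈) = cong suc (toggle-size x p x∈)
toggle-size (suc x) (false ∷ p) (there x∈) = toggle-size x p x∈

toggle-⊆ : ∀ (x : Fin n) p → toggle x p ⊆ ⁅ x ⁆ ∪ p
toggle-⊆ x p {y} y∈ with y ≟ᶠ x
... | yes refl = x∈p∪q⁺ (inj₁ (x∈⁅x⁆ x))
... | no  y≢x  = x∈p∪q⁺ (inj₂ (subst (y ∈ₛ_) (toggle-involutive x p) (updateAt-minimal y x (toggle x p) y≢x y∈)))

star : ∀ {r} → Fin n → Hypergraph r n → List (Subset n)
star x H = filter (x ∈?_) (edges H)

link : ∀ {r} → Fin n → Hypergraph (suc r) n → Hypergraph r n
link {r = r} x H = record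
  { edges   = map (toggle x) (star x H)
  ; uniform = All.map⁺ (All.map drop-x
                (All.zip (All.all-filter (x ∈?_) (edges H) , All.filter⁺ (x ∈?_) (uniform H))))
  ; simple  = Unique.map⁺ (toggle-injective x) (Unique.filter⁺ (x ∈?_) (simple H))
  }
  where
  drop-x : ∀ {E} → x ∈ₛ E × ∣ E ∣ ≡ suc r → ∣ toggle x E ∣ ≡ r
  drop-x {E} (x∈E , size) = suc-injective (trans (toggle-size x E x∈E) size)

-- A (v,e)-configuration in a link gives a (v+1,e)-configuration in H:
-- add x back to each of its edges.
link-free : ∀ {r v e} (H : Hypergraph (suc r) n) (x : Fin n) →
  ¬ ContainsConfig (suc v) e H → ¬ ContainsConfig v e (link x H)
link-free {v = v} H x free (L , unique , L⊆link , length-L , small) =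
  free (map (toggle x) L , Unique.map⁺ (toggle-injective x) unique , All.map⁺ (All.map restore L⊆link) ,
        trans (length-map (toggle x) L) length-L , size)
  where
  restore : ∀ {E} → E List.∈ edges (link x H) → toggle x E List.∈ edges H
  restore E∈ with List.∈-map⁻ (toggle x) E∈
  ... | F , F∈star , refl =
    subst (List._∈ edges H) (sym (toggle-involutive x F)) (proj₁ (List.∈-filter⁻ (x ∈?_) F∈star))
  restored-⊆ : ⋃ (map (toggle x) L) ⊆ ⁅ x ⁆ ∪ ⋃ L
  restored-⊆ = ⋃-least (map (toggle x) L) (All.map⁺ (All.tabulate λ {E} E∈L →
    ⊆-trans (toggle-⊆ x E) (∪-mono ⊆-refl (⋃-upper L E∈L))))
  size : ∣ ⋃ (map (toggle x) L) ∣ ≤ suc v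
  size = begin
    ∣ ⋃ (map (toggle x) L) ∣ ≤⟨ p⊆q⇒∣p∣≤∣q∣ restored-⊆ ⟩
    ∣ ⁅ x ⁆ ∪ ⋃ L ∣          ≤⟨ ∣p∪q∣≤∣p∣+∣q∣ ⁅ x ⁆ (⋃ L) ⟩
    ∣ ⁅ x ⁆ ∣ + ∣ ⋃ L ∣      ≡⟨ cong (_+ ∣ ⋃ L ∣) (∣⁅x⁆∣≡1 x) ⟩
    suc ∣ ⋃ L ∣              ≤⟨ s≤s small ⟩
    suc v                    ∎
    where open ≤-Reasoning

edge-vertex : ∀ {r} (E : Subset n) → ∣ E ∣ ≡ suc r → Nonempty E
edge-vertex {n} E size with nonempty? E
... | yes nonempty = nonempty
... | no  empty    = contradiction (trans (sym size) (trans (cong ∣_∣ (Empty-unique empty)) (∣⊥∣≡0 n))) λ ()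

-- One link step: |H| ≤ Σ_x |link x H| ≤ n B.
link-step : ∀ {r v e} B (H : Hypergraph (suc r) n) → ¬ ContainsConfig (suc v) e H →
  (∀ (H′ : Hypergraph r n) → ¬ ContainsConfig v e H′ → numEdges H′ ≤ B) →
  numEdges H ≤ n * B
link-step {n} B H free bound = begin
  numEdges H                                    ≤⟨ double-count (allFin n) (edges H) covered ⟩
  sum (map (λ x → degree x (edges H)) (allFin n)) ≤⟨ sum-map-bound (allFin n) link-bound ⟩
  length (allFin n) * B                         ≡⟨ cong (_* B) (length-tabulate {n = n} id) ⟩
  n * B                                         ∎
  where
  open ≤-Reasoning
  open DoubleCounting (λ x E → x ∈ₛ E) (λ x → x ∈?_)
  covered : All (λ E → Any (_∈ₛ E) (allFin n)) (edges H)
  covered = All.map (λ {E} size → let x , x∈E = edge-vertex E size in List.lose (List.∈-allFin x) x∈E) (uniform H)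
  link-bound : ∀ x → degree x (edges H) ≤ B
  link-bound x = ≤-trans (≤-reflexive (sym (length-map (toggle x) (star x H)))) (bound (link x H) (link-free H x free))

link-iterate : ∀ {r v e B} j → (∀ (H′ : Hypergraph r n) → ¬ ContainsConfig v e H′ → numEdges H′ ≤ B) →
  ∀ (H : Hypergraph (j + r) n) → ¬ ContainsConfig (j + v) e H → numEdges H ≤ n ^ j * B
link-iterate {B = B} zero bound H free = ≤-trans (bound H free) (≤-reflexive (sym (*-identityˡ B)))
link-iterate {n} {B = B} (suc j) bound H free =
  ≤-trans (link-step (n ^ j * B) H free (link-iterate j bound)) (≤-reflexive (sym (*-assoc n (n ^ j) B)))

prefix : ℕ → Subset n → Subset n
prefix zero    p           = ⊥
prefix (suc j) []          = []
prefix (suc j) (true ∷ p)  = true ∷ prefix j p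
prefix (suc j) (false ∷ p) = false ∷ prefix (suc j) p

suffix : ℕ → Subset n → Subset n
suffix zero    p           = p
suffix (suc j) []          = []
suffix (suc j) (true ∷ p)  = false ∷ suffix j p
suffix (suc j) (false ∷ p) = false ∷ suffix (suc j) p

prefix-∪-suffix : ∀ j (p : Subset n) → prefix j p ∪ suffix j p ≡ p
prefix-∪-suffix zero    p           = ∪-identityˡ p
prefix-∪-suffix (suc j) []          = refl
prefix-∪-suffix (suc j) (true ∷ p)  = cong (true ∷_) (prefix-∪-suffix j p)
prefix-∪-suffix (suc j) (false ∷ p) = cong (false ∷_) (prefix-∪-suffix (suc j) p)

∣prefix∣+∣suffix∣ : ∀ j (p : Subset n) → ∣ prefix j p ∣ + ∣ suffix j p ∣ ≡ ∣ p ∣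
∣prefix∣+∣suffix∣ {n} zero    p       = cong (_+ ∣ p ∣) (∣⊥∣≡0 n)
∣prefix∣+∣suffix∣     (suc j) []          = refl
∣prefix∣+∣suffix∣     (suc j) (true ∷ p)  = cong suc (∣prefix∣+∣suffix∣ j p)
∣prefix∣+∣suffix∣     (suc j) (false ∷ p) = ∣prefix∣+∣suffix∣ (suc j) p

∣prefix∣ : ∀ j (p : Subset n) → j ≤ ∣ p ∣ → ∣ prefix j p ∣ ≡ j
∣prefix∣ {n} zero    p           _         = ∣⊥∣≡0 n
∣prefix∣     (suc j) (true ∷ p)  (s≤s j≤p) = cong suc (∣prefix∣ j p j≤p)
∣prefix∣     (suc j) (false ∷ p) j≤p       = ∣prefix∣ (suc j) p j≤p

-- Traces.  Fix the edge size m + s; the trace of an edge is its prefix of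
-- length m.

module Trace (m s : ℕ) where

  prefix-size : (E : Subset n) → ∣ E ∣ ≡ m + s → ∣ prefix m E ∣ ≡ m
  prefix-size E size = ∣prefix∣ m E (subst (m ≤_) (sym size) (m≤m+n m s))

  suffix-size : (E : Subset n) → ∣ E ∣ ≡ m + s → ∣ suffix m E ∣ ≡ s
  suffix-size E size = +-cancelˡ-≡ m _ s (begin
    m + ∣ suffix m E ∣               ≡⟨ cong (_+ ∣ suffix m E ∣) (prefix-size E size) ⟨
    ∣ prefix m E ∣ + ∣ suffix m E ∣  ≡⟨ ∣prefix∣+∣suffix∣ m E ⟩
    ∣ E ∣                            ≡⟨ size ⟩
    m + s                            ∎)
    where open ≡-Reasoning

  -- Each edge adds at most s vertices to the union of the traces.
  ∣⋃∣≤traces : (M : List (Subset n)) → All (λ E → ∣ E ∣ ≡ m + s) M →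
    ∣ ⋃ M ∣ ≤ ∣ ⋃ (map (prefix m) M) ∣ + length M * s
  ∣⋃∣≤traces {n} M sizes = begin
    ∣ ⋃ M ∣                                 ≤⟨ p⊆q⇒∣p∣≤∣q∣ split ⟩
    ∣ ⋃ prefixes ∪ ⋃ suffixes ∣             ≤⟨ ∣p∪q∣≤∣p∣+∣q∣ (⋃ prefixes) (⋃ suffixes) ⟩
    ∣ ⋃ prefixes ∣ + ∣ ⋃ suffixes ∣         ≤⟨ +-monoʳ-≤ ∣ ⋃ prefixes ∣ suffixes-bound ⟩
    ∣ ⋃ (map (prefix m) M) ∣ + length M * s ∎
    where
    open ≤-Reasoning
    prefixes suffixes : List (Subset n)
    prefixes = map (prefix m) M
    suffixes = map (suffix m) M
    split : ⋃ M ⊆ ⋃ prefixes ∪ ⋃ suffixes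
    split = ⋃-least M (All.tabulate λ {E} E∈M →
      ⊆-trans (⊆-reflexive (sym (prefix-∪-suffix m E)))
              (∪-mono (⋃-upper _ (List.∈-map⁺ (prefix m) E∈M)) (⋃-upper _ (List.∈-map⁺ (suffix m) E∈M))))
    suffixes-bound : ∣ ⋃ suffixes ∣ ≤ length M * s
    suffixes-bound = subst (λ ℓ → ∣ ⋃ suffixes ∣ ≤ ℓ * s) (length-map (suffix m) M)
      (∣⋃∣≤length*size suffixes (All.map⁺ (All.map (λ {E} size → ≤-reflexive (suffix-size E size)) sizes)))

  common-trace : ∀ {g : Subset n} M → All (λ E → prefix m E ≡ g) M → All (λ E → ∣ E ∣ ≡ m + s) M →
    ∣ ⋃ (map (prefix m) M) ∣ ≤ m
  common-trace {n} []      []               []             = ≤-trans (≤-reflexive (∣⊥∣≡0 n)) z≤n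
  common-trace {g = g} (E ∷ M) traces@(trace-E ∷ _) (size-E ∷ _) = begin
    ∣ ⋃ (map (prefix m) (E ∷ M)) ∣ ≤⟨ p⊆q⇒∣p∣≤∣q∣ (⋃-least _ (All.map⁺ (All.map ⊆-reflexive traces))) ⟩
    ∣ g ∣                          ≡⟨ cong ∣_∣ trace-E ⟨
    ∣ prefix m E ∣                 ≡⟨ prefix-size E size-E ⟩
    m                              ∎
    where open ≤-Reasoning

  module _ {n w e b : ℕ} (m≤w : m ≤ w)
           (f-bound : ∀ (G : Hypergraph m n) → ¬ ContainsConfig w e G → numEdges G ≤ b)
           (H : Hypergraph (m + s) n) (free : ¬ ContainsConfig (w + e * s) e H) where

    open DoubleCounting (λ (g E : Subset n) → prefix m E ≡ g) (λ g E → prefix m E ≟ₛ g)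

    -- A fibre has at most e edges: e edges with a common trace span at most
    -- m + e s ≤ w + e s vertices.
    fibre-bound : ∀ g → degree g (edges H) ≤ e
    fibre-bound g with degree g (edges H) ≤? e
    ... | yes small = small
    ... | no  large = contradiction configuration free
      where
      fibre : List (Subset n)
      fibre = filter (λ E → prefix m E ≟ₛ g) (edges H)
      chosen : List (Subset n)
      chosen = take e fibre
      length-chosen : length chosen ≡ e
      length-chosen = trans (length-take e fibre) (m≤n⇒m⊓n≡m (<⇒≤ (≰⇒> large)))
      sizes : All (λ E → ∣ E ∣ ≡ m + s) chosen
      sizes = All.take⁺ e (All.filter⁺ _ (uniform H))
      size : ∣ ⋃ chosen ∣ ≤ w + e * s
      size = begin
        ∣ ⋃ chosen ∣                                      ≤⟨ ∣⋃∣≤traces chosen sizes ⟩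
        ∣ ⋃ (map (prefix m) chosen) ∣ + length chosen * s ≤⟨ +-mono-≤ common length-term ⟩
        w + e * s                                         ∎
        where
        open ≤-Reasoning
        length-term : length chosen * s ≤ e * s
        length-term = ≤-reflexive (cong (_* s) length-chosen)
        common : ∣ ⋃ (map (prefix m) chosen) ∣ ≤ w
        common = ≤-trans (common-trace chosen (All.take⁺ e (All.all-filter _ (edges H))) sizes) m≤w
      configuration : ContainsConfig (w + e * s) e H
      configuration = chosen , Unique.take⁺ e (Unique.filter⁺ _ (simple H)) ,
                      All.take⁺ e (All.filter⁺ _ (All.tabulate id)) , length-chosen , size

    traces : List (Subset n)
    traces = deduplicate _≟ₛ_ (map (prefix m) (edges H))

    trace-graph : Hypergraph m n
    trace-graph = record
      { edges   = traces
      ; uniform = All.deduplicate⁺ _≟ₛ_ (All.map⁺ (All.map (λ {E} → prefix-size E) (uniform H)))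
      ; simple  = Unique.deduplicate-! _≟ₛ_ (map (prefix m) (edges H))
      }

    lift : ∀ M → All (List._∈ map (prefix m) (edges H)) M →
      Σ (List (Subset n)) λ K → map (prefix m) K ≡ M × All (List._∈ edges H) K
    lift []      []           = [] , refl , []
    lift (g ∷ M) (g∈ ∷ M⊆) with List.∈-map⁻ (prefix m) g∈ | lift M M⊆
    ... | E , E∈H , refl | K , refl , K⊆H = E ∷ K , refl , E∈H ∷ K⊆H

    -- A (w,e)-configuration of traces lifts to a (w + e s, e)-configuration of H.
    trace-free : ¬ ContainsConfig w e trace-graph
    trace-free (M , unique , M⊆traces , length-M , small)
      with lift M (All.map (List.∈-deduplicate⁻ _≟ₛ_ (map (prefix m) (edges H))) M⊆traces)
    ... | K , refl , K⊆H = free (K , Unique.map⁻ unique , K⊆H , length-K , size)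
      where
      length-K : length K ≡ e
      length-K = trans (sym (length-map (prefix m) K)) length-M
      size : ∣ ⋃ K ∣ ≤ w + e * s
      size = ≤-trans (∣⋃∣≤traces K (All.map (All.lookup (uniform H)) K⊆H))
                     (+-mono-≤ small (≤-reflexive (cong (_* s) length-K)))

    -- |H| is the sum of the fibre sizes, each at most e, over the traces.
    trace-bound : numEdges H ≤ b * e
    trace-bound = begin
      numEdges H                                        ≤⟨ double-count traces (edges H) covered ⟩
      sum (map (λ g → degree g (edges H)) traces)       ≤⟨ sum-map-bound traces fibre-bound ⟩
      length traces * e                                 ≤⟨ *-monoˡ-≤ e (f-bound trace-graph trace-free) ⟩
      b * e                                             ∎
      where
      open ≤-Reasoning
      covered : All (λ E → prefix m E List.∈ traces) (edges H)
      covered = All.tabulate (λ E∈H → List.∈-deduplicate⁺ _≟ₛ_ (List.∈-map⁺ (prefix m) E∈H))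

binomial-positive : ∀ m k → k ≤ m → 1 ≤ m C k
binomial-positive m       zero    _         = ≤-refl
binomial-positive (suc m) (suc k) (s≤s k≤m) = begin
  1                     ≤⟨ binomial-positive m k k≤m ⟩
  m C k                 ≤⟨ m≤m+n (m C k) (m C suc k) ⟩
  m C k + m C suc k     ≡⟨ nCk+nC[k+1]≡[n+1]C[k+1] m k ⟩
  suc m C suc k         ∎
  where open ≤-Reasoning

uniformity-shape : ∀ j {r} → 2 + j < r → ∃ λ s → j + (3 + s) ≡ r
uniformity-shape j lt with s , eq ← m≤n⇒∃[o]m+o≡n lt =
  s , trans (sym (+-assoc j 3 s)) (trans (cong (_+ s) (+-comm j 3)) eq)

order-shape : ∀ j s e d → (j + (3 + s) ∸ (2 + j)) * e + (2 + j) + d ≡ j + ((e + 2 + d) + e * s)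
order-shape j s e d = begin
  (j + (3 + s) ∸ (2 + j)) * e + (2 + j) + d ≡⟨ cong (λ t → t * e + (2 + j) + d) difference ⟩
  suc s * e + (2 + j) + d                   ≡⟨ regroup j s e d ⟩
  j + ((e + 2 + d) + e * s)                 ∎
  where
  open ≡-Reasoning
  difference : j + (3 + s) ∸ (2 + j) ≡ suc s
  difference = trans (cong (_∸ (2 + j)) (trans (+-suc j (2 + s)) (cong suc (+-suc j (suc s)))))
                     (m+n∸m≡n (2 + j) (suc s))
  regroup : ∀ j s e d → suc s * e + (2 + j) + d ≡ j + ((e + 2 + d) + e * s)
  regroup = solve-∀

absorb-positive : ∀ c e x b → 1 ≤ c → x * (b * e) ≤ c * e * x * b
absorb-positive c e x b 1≤c = begin
  x * (b * e)     ≡⟨ rearrange e x b ⟩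
  1 * e * x * b   ≤⟨ *-monoˡ-≤ b (*-monoˡ-≤ x (*-monoˡ-≤ e 1≤c)) ⟩
  c * e * x * b   ∎
  where
  open ≤-Reasoning
  rearrange : ∀ e x b → x * (b * e) ≡ 1 * e * x * b
  rearrange = solve-∀

proposition1p3 : ∀ (k r e d n : ℕ) → 2 ≤ k → k < r → 3 ≤ e → 1 ≤ d → 1 ≤ n →
    ∀ (a b : ℕ) →
    IsF r n ((r ∸ k) * e + k + d) e a →
    IsF 3 n (e + 2 + d) e b →
    a ≤ (r C 3) * e * n ^ (k ∸ 2) * b
proposition1p3 k r e d n 2≤k k<r 3≤e _ _ a b ((H , H-free , H-size) , _) (_ , f₃-bound)
  with j , refl ← m≤n⇒∃[o]m+o≡n 2≤k
  with s , refl ← uniformity-shape j k<r = begin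
    a                       ≡⟨ H-size ⟨
    numEdges H              ≤⟨ link-iterate j (Trace.trace-bound 3 s 3≤w f₃-bound) H H-free′ ⟩
    n ^ j * (b * e)         ≤⟨ absorb-positive (r C 3) e (n ^ j) b (binomial-positive r 3 3≤r) ⟩
    (r C 3) * e * n ^ j * b ∎
  where
  open ≤-Reasoning
  3≤w : 3 ≤ e + 2 + d
  3≤w = ≤-trans 3≤e (≤-trans (m≤m+n e 2) (m≤m+n (e + 2) d))
  3≤r : 3 ≤ j + (3 + s)
  3≤r = ≤-trans (m≤m+n 3 s) (m≤n+m (3 + s) j)
  H-free′ : ¬ ContainsConfig (j + ((e + 2 + d) + e * s)) e H
  H-free′ = subst (λ v → ¬ ContainsConfig v e H) (order-shape j s e d) H-free
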